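{- Let $p$ be a positive integer such that $M_p:=2^p-1$ is a prime number. Then $\ell_{\mathbb{F}_{M_p+1}}\geq 3M_p$.
   Context: For a commutative unital ring $A$ and $a_1,\ldots,a_n\in A$ set $M_n(a_1,\ldots,a_n)=\begin{pmatrix} a_n & -1_A\\ 1_A & 0_A\end{pmatrix}\cdots\begin{pmatrix} a_1 & -1_A\\ 1_A & 0_A\end{pmatrix}$. An $n$-tuple is a $\lambda$-quiddity if $M_n(a_1,\ldots,a_n)=\pm \mathrm{Id}$. For tuples, $(a_1,\ldots,a_n)\oplus(b_1,\ldots,b_m)=(a_1+b_m,a_2,\ldots,a_{n-1},a_n+b_1,b_2,\ldots,b_{m-1})$. Write $(a_1,\ldots,a_n)\sim(b_1,\ldots,b_n)$ if $(b_1,\ldots,b_n)$ is obtained from $(a_1,\ldots,a_n)$ or from $(a_n,\ldots,a_1)$ by a cyclic permutation. A $\lambda$-quiddity $(c_1,\ldots,c_n)$ with $n\geq 3$ is reducible if there exist a $\lambda$-quiddity $(b_1,\ldots,b_l)$ and a tuple $(a_1,\ldots,a_m)$ with $l,m\geq 3$ and $(c_1,\ldots,c_n)\sim(a_1,\ldots,a_m)\oplus(b_1,\ldots,b_l)$; otherwise irreducible. For finite $A$ there are finitely many irreducible $\lambda$-quiddities, and $\ell_A$ denotes their maximal size. $\mathbb{F}_q$ is the field with $q$ elements. -}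

module Defs where

open import Level using (Level; _⊔_)
open import Algebra.Bundles using (CommutativeRing)
open import Data.Nat using (ℕ; _≤_; _<_)
open import Data.Fin using (Fin)
open import Data.List using (List; []; _∷_; _++_; length; drop; take; reverse)
open import Data.List.Relation.Binary.Pointwise using (Pointwise)
open import Data.Product using (Σ; ∃; ∃-syntax; _×_; _,_)
open import Data.Sum using (_⊎_)
open import Relation.Nullary using (¬_)
open import Function.Bundles using (Bijection)
import Relation.Binary.PropositionalEquality as ≡

IsField : ∀ {c ℓ} → CommutativeRing c ℓ → Set (c ⊔ ℓ)
IsField R = (¬ (0# ≈ 1#)) × (∀ x → ¬ (x ≈ 0#) → ∃[ y ] (x * y ≈ 1#))
  where open CommutativeRing R

HasCard : ∀ {c ℓ} → CommutativeRing c ℓ → ℕ → Set (c ⊔ ℓ)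
HasCard R q = Bijection (CommutativeRing.setoid R) (≡.setoid (Fin q))

module Quiddity {c ℓ} (R : CommutativeRing c ℓ) where
  open CommutativeRing R

  record Mat : Set c where
    constructor mat
    field m11 m12 m21 m22 : Carrier

  _·_ : Mat → Mat → Mat
  mat a b c' d · mat e f g h =
    mat (a * e + b * g) (a * f + b * h) (c' * e + d * g) (c' * f + d * h)

  Id : Mat
  Id = mat 1# 0# 0# 1#

  -Id : Mat
  -Id = mat (- 1#) 0# 0# (- 1#)

  _≈M_ : Mat → Mat → Set ℓ
  mat a b c' d ≈M mat e f g h = (a ≈ e) × (b ≈ f) × (c' ≈ g) × (d ≈ h)

  S : Carrier → Mat
  S a = mat a (- 1#) 1# 0#

  -- M_n(a_1,...,a_n) = S(a_n) ⋯ S(a_1)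
  Mtuple : List Carrier → Mat
  Mtuple = go Id
    where
      go : Mat → List Carrier → Mat
      go acc []       = acc
      go acc (a ∷ as) = go (S a · acc) as

  IsLambdaQuiddity : List Carrier → Set ℓ
  IsLambdaQuiddity as = (Mtuple as ≈M Id) ⊎ (Mtuple as ≈M -Id)

  lastOr : Carrier → List Carrier → Carrier
  lastOr d []       = d
  lastOr d (x ∷ xs) = lastOr x xs

  init′ : List Carrier → List Carrier
  init′ []           = []
  init′ (x ∷ [])     = []
  init′ (x ∷ y ∷ xs) = x ∷ init′ (y ∷ xs)

  -- (a_1,...,a_n) ⊕ (b_1,...,b_m)
  --   = (a_1 + b_m, a_2, ..., a_{n-1}, a_n + b_1, b_2, ..., b_{m-1})
  -- (only used for n, m ≥ 3; the empty cases are junk values)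
  _⊕_ : List Carrier → List Carrier → List Carrier
  []       ⊕ bs       = []
  (a ∷ as) ⊕ []       = []
  (a ∷ as) ⊕ (b ∷ bs) = (a + lastOr b bs) ∷ (init′ as ++ ((lastOr a as + b) ∷ init′ bs))

  rotate : ℕ → List Carrier → List Carrier
  rotate k xs = drop k xs ++ take k xs

  _≈T_ : List Carrier → List Carrier → Set (c ⊔ ℓ)
  _≈T_ = Pointwise _≈_

  _∼_ : List Carrier → List Carrier → Set (c ⊔ ℓ)
  as ∼ bs = ∃[ k ] (k < length as × (bs ≈T rotate k as ⊎ bs ≈T rotate k (reverse as)))

  Reducible : List Carrier → Set (c ⊔ ℓ)
  Reducible cs = ∃[ bs ] ∃[ as ]
    (IsLambdaQuiddity bs × 3 ≤ length bs × 3 ≤ length as × cs ∼ (as ⊕ bs))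

  Irreducible : List Carrier → Set (c ⊔ ℓ)
  Irreducible cs = IsLambdaQuiddity cs × 3 ≤ length cs × ¬ Reducible cs

{-# OPTIONS --safe #-}
-- In a field with q = n + 1 elements, n an odd prime, Fermat gives (−1)ⁿ = 1, so the characteristic is 2,
-- and every a ∉ {0, 1} has multiplicative order n. A counting argument on roots gives some a ≠ 1 for which
-- a x² + x + a has no root; put b = a⁻¹. Reading one period (a, b, a) multiplies the two terms of the
-- continuant recurrence by a and b, so (a, a, b)ⁿ is a λ-quiddity of length 3n. For a λ-quiddity
-- (b₁, …, bₗ) the continuant of (b₂, …, bₗ₋₁) is ±1, so writing a rotation of (a, a, b)ⁿ or of its reverse
-- as (a₁, …, aₘ) ⊕ (b₁, …, bₗ) would produce a segment of length between 1 and 3n − 3 with continuant 1.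
-- But the continuant of such a segment is 0, or aᵏ or bᵏ with 0 < k < n, or a^(j+2) + b^j, and the last
-- equals 1 only if a^(j+1) is a root of a x² + x + a.

module Submission where

open import Defs
open import Algebra.Bundles using (CommutativeRing; CommutativeSemiring)
open import Data.Empty using (⊥-elim)
open import Data.List using (List; []; _∷_; _∷ʳ_; _++_; foldl; length; drop; take; reverse)
open import Data.List.Properties using (foldl-∷ʳ; reverse-++)
import Data.List.Relation.Binary.Pointwise as Pointwise
open import Data.List.Relation.Binary.Pointwise.Properties using (Pointwise-length)
open import Data.List.Relation.Binary.Pointwise using ([]; _∷_)
open import Data.Product.Relation.Binary.Pointwise.NonDependent using (×-setoid)
open import Data.Fin using (Fin; zero; suc; punchIn; punchOut)
import Data.Fin.Properties as FinP
open import Data.Fin.Permutation using (permutation)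
open import Data.Nat as ℕ using (ℕ; zero; suc; _<_; _≤_; _∸_; z≤n; s≤s)
import Data.Nat.Properties as ℕP
open import Data.Nat.DivMod using (_divMod_; result)
open import Data.Nat.Coprimality using (Coprime; coprime-Bézout; prime⇒coprime)
open import Data.Nat.Primality using (Prime; prime⇒nonTrivial)
open import Data.Nat.GCD using (module Bézout)
open import Level using (_⊔_)
open import Data.Product using (∃; ∃-syntax; _×_; _,_; proj₁; proj₂)
open import Data.Sum using (_⊎_; inj₁; inj₂; [_,_])
open import Function using (_∘_; id)
open import Function.Bundles using (Bijection)
open import Function.Definitions using (Injective)
open import Relation.Binary.Bundles using (Setoid)
open import Relation.Binary.Definitions using (Decidable)
import Relation.Binary.PropositionalEquality as ≡
open import Relation.Nullary using (¬_; Dec; yes; no; ¬?)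
open import Relation.Nullary.Decidable using (map′; _×-dec_)
open import Relation.Unary using (Pred)
import Relation.Binary.Reasoning.Setoid as SetoidReasoning

HasCharacteristic2 : ∀ {c ℓ} → CommutativeRing c ℓ → Set ℓ
HasCharacteristic2 R = 1# + 1# ≈ 0#
  where open CommutativeRing R

module FiniteSetoid {c ℓ} (S : Setoid c ℓ) {q : ℕ} (card : Bijection S (≡.setoid (Fin q))) where
  open Setoid S
  open Bijection card using (strictlySurjective)
  open Bijection card public using ()
    renaming (to to index; to⁻ to element; cong to index-cong; injective to index-injective)

  index-element : ∀ i → index (element i) ≡.≡ i
  index-element i = proj₂ (strictlySurjective i)

  element-index : ∀ x → element (index x) ≈ x
  element-index x = index-injective (index-element (index x))

  element-injective : ∀ {i j} → element i ≈ element j → i ≡.≡ j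
  element-injective {i} {j} e = ≡.trans (≡.sym (index-element i)) (≡.trans (index-cong e) (index-element j))

  infix 4 _≟_
  _≟_ : Decidable _≈_
  x ≟ y = map′ index-injective index-cong (index x FinP.≟ index y)

  search : ∀ {p} {P : Pred Carrier p} → (∀ {x y} → x ≈ y → P x → P y) → (∀ x → Dec (P x)) →
           Dec (∃ P)
  search resp P? = map′ (λ (i , Pi) → element i , Pi) (λ (x , Px) → index x , resp (sym (element-index x)) Px)
    (FinP.any? (P? ∘ element))

  injective⇒surjective : ∀ (f : Fin q → Carrier) → (∀ {i j} → f i ≈ f j → i ≡.≡ j) →
                         ∀ y → ∃ λ i → f i ≈ y
  injective⇒surjective f f-injective y with FinP.any? (λ i → f i ≟ y)
  ... | yes hit = hit
  ... | no miss = ⊥-elim (FinP.<⇒notInjective (ℕP.n<1+n q) g-injective)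
    where
    g : Fin (suc q) → Fin q
    g zero    = index y
    g (suc i) = index (f i)

    g-injective : Injective ≡._≡_ ≡._≡_ g
    g-injective {zero}  {zero}  _ = ≡.refl
    g-injective {zero}  {suc j} e = ⊥-elim (miss (j , sym (index-injective e)))
    g-injective {suc i} {zero}  e = ⊥-elim (miss (i , index-injective e))
    g-injective {suc i} {suc j} e = ≡.cong suc (f-injective (index-injective e))

  third-element : 2 < q → ∀ u v → ∃ λ x → ¬ x ≈ u × ¬ x ≈ v
  third-element 2<q u v
    with search (λ x≈y (x≉u , x≉v) → x≉u ∘ trans x≈y , x≉v ∘ trans x≈y)
                (λ x → ¬? (x ≟ u) ×-dec ¬? (x ≟ v))
  ... | yes found = found
  ... | no none = ⊥-elim (FinP.<⇒notInjective 2<q side-injective)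
    where
    side : ∀ x → x ≈ u ⊎ x ≈ v
    side x with x ≟ u | x ≟ v
    ... | yes x≈u | _       = inj₁ x≈u
    ... | no _    | yes x≈v = inj₂ x≈v
    ... | no x≉u  | no x≉v  = ⊥-elim (none (x , x≉u , x≉v))

    side-index : Fin q → Fin 2
    side-index i = [ (λ _ → zero) , (λ _ → suc zero) ] (side (element i))

    side-injective : Injective ≡._≡_ ≡._≡_ side-index
    side-injective {i} {j} e with side (element i) | side (element j)
    ... | inj₁ i≈u | inj₁ j≈u = element-injective (trans i≈u (sym j≈u))
    ... | inj₂ i≈v | inj₂ j≈v = element-injective (trans i≈v (sym j≈v))

module Powers {c ℓ} (R : CommutativeSemiring c ℓ) where
  open CommutativeSemiring R
  open import Algebra.Properties.CommutativeSemiring.Exp R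
  open SetoidReasoning setoid

  1^n≈1 : ∀ n → 1# ^ n ≈ 1#
  1^n≈1 zero    = refl
  1^n≈1 (suc n) = trans (*-identityˡ _) (1^n≈1 n)

  ^≈1⇒^[k*m]≈1 : ∀ {x} m k → x ^ m ≈ 1# → x ^ (k ℕ.* m) ≈ 1#
  ^≈1⇒^[k*m]≈1 {x} m k xᵐ≈1 = begin
    x ^ (k ℕ.* m) ≡⟨ ≡.cong (x ^_) (ℕP.*-comm k m) ⟩
    x ^ (m ℕ.* k) ≈⟨ ^-assocʳ x m k ⟨
    (x ^ m) ^ k   ≈⟨ ^-congˡ k xᵐ≈1 ⟩
    1# ^ k        ≈⟨ 1^n≈1 k ⟩
    1#            ∎

  private
    bézout⇒≈1 : ∀ {x} m n u v → 1 ℕ.+ v ℕ.* n ≡.≡ u ℕ.* m →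
                x ^ m ≈ 1# → x ^ n ≈ 1# → x ≈ 1#
    bézout⇒≈1 {x} m n u v 1+vn≡um xᵐ≈1 xⁿ≈1 = begin
      x                   ≈⟨ *-identityʳ x ⟨
      x * 1#              ≈⟨ *-congˡ (^≈1⇒^[k*m]≈1 n v xⁿ≈1) ⟨
      x ^ (1 ℕ.+ v ℕ.* n) ≡⟨ ≡.cong (x ^_) 1+vn≡um ⟩
      x ^ (u ℕ.* m)       ≈⟨ ^≈1⇒^[k*m]≈1 m u xᵐ≈1 ⟩
      1#                  ∎

  coprime-exponents⇒≈1 : ∀ {m n x} → Coprime m n → x ^ m ≈ 1# → x ^ n ≈ 1# → x ≈ 1#
  coprime-exponents⇒≈1 {m} {n} coprime xᵐ≈1 xⁿ≈1 with coprime-Bézout coprime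
  ... | Bézout.+- u v 1+vn≡um = bézout⇒≈1 m n u v 1+vn≡um xᵐ≈1 xⁿ≈1
  ... | Bézout.-+ u v 1+um≡vn = bézout⇒≈1 n m v u 1+um≡vn xⁿ≈1 xᵐ≈1

module Characteristic2 {c ℓ} (R : CommutativeRing c ℓ)
  (1+1≈0 : HasCharacteristic2 R) where
  open CommutativeRing R hiding (zero)
  open import Algebra.Properties.Ring ring using (+-inverseʳ-unique)
  open SetoidReasoning setoid

  x+x≈0 : ∀ x → x + x ≈ 0#
  x+x≈0 x = begin
    x + x           ≈⟨ +-cong (*-identityʳ x) (*-identityʳ x) ⟨
    x * 1# + x * 1# ≈⟨ distribˡ x 1# 1# ⟨
    x * (1# + 1#)   ≈⟨ *-congˡ 1+1≈0 ⟩
    x * 0#          ≈⟨ zeroʳ x ⟩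
    0#              ∎

  -x≈x : ∀ x → - x ≈ x
  -x≈x x = sym (+-inverseʳ-unique x x (x+x≈0 x))

  x+[x+y]≈y : ∀ x y → x + (x + y) ≈ y
  x+[x+y]≈y x y = trans (sym (+-assoc x x y)) (trans (+-congʳ (x+x≈0 x)) (+-identityˡ y))

  x+y≈0⇒x≈y : ∀ {x y} → x + y ≈ 0# → x ≈ y
  x+y≈0⇒x≈y {x} {y} x+y≈0 = trans (sym (-x≈x x)) (sym (+-inverseʳ-unique x y x+y≈0))

  [x+1]²≈x²+1 : ∀ x → (x + 1#) * (x + 1#) ≈ x * x + 1#
  [x+1]²≈x²+1 x = begin
    (x + 1#) * (x + 1#)                   ≈⟨ solve 2 (λ x o →
      (x :+ o) :* (x :+ o) := (x :* o :+ x :* o) :+ (x :* x :+ o :* o)) refl x 1# ⟩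
    (x * 1# + x * 1#) + (x * x + 1# * 1#) ≈⟨ +-congʳ (x+x≈0 _) ⟩
    0# + (x * x + 1# * 1#)               ≈⟨ +-identityˡ _ ⟩
    x * x + 1# * 1#                      ≈⟨ +-congˡ (*-identityˡ 1#) ⟩
    x * x + 1#                           ∎
    where
    open import Algebra.Solver.Ring.NaturalCoefficients.Default commutativeSemiring
      using (solve; _:=_; _:+_; _:*_)

module FiniteField {c ℓ} (F : CommutativeRing c ℓ) (isField : IsField F) {n : ℕ} (card : HasCard F (suc n))
  where
  open CommutativeRing F hiding (zero)
  open import Algebra.Properties.Ring ring using (-1*x≈-x; -‿involutive; -0#≈0#)
  open import Algebra.Properties.CommutativeSemiring.Exp commutativeSemiring
  open import Algebra.Properties.CommutativeMonoid.Sum *-commutativeMonoid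
    using () renaming (sum to ∏; sum-replicate to ∏-replicate; sum-cong-≋ to ∏-cong;
                       ∑-distrib-+ to ∏-distrib-*; ∑-permute to ∏-permute)
  open FiniteSetoid setoid card public
  open Powers commutativeSemiring
  open SetoidReasoning setoid

  0≉1 : ¬ 0# ≈ 1#
  0≉1 = proj₁ isField

  inverse : ∀ {x} → ¬ x ≈ 0# → ∃ λ y → x * y ≈ 1#
  inverse = proj₂ isField _

  private
    *-inverse-cancel : ∀ {z w} x → z * w ≈ 1# → w * (z * x) ≈ x
    *-inverse-cancel {z} {w} x zw≈1 =
      trans (sym (*-assoc w z x)) (trans (*-congʳ (trans (*-comm w z) zw≈1)) (*-identityˡ x))

  *-cancelˡ-≉0 : ∀ {x y z} → ¬ z ≈ 0# → z * x ≈ z * y → x ≈ y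
  *-cancelˡ-≉0 {x} {y} z≉0 zx≈zy = let (w , zw≈1) = inverse z≉0 in begin
    x            ≈⟨ *-inverse-cancel x zw≈1 ⟨
    w * (_ * x)  ≈⟨ *-congˡ zx≈zy ⟩
    w * (_ * y)  ≈⟨ *-inverse-cancel y zw≈1 ⟩
    y            ∎

  x*y≈0⇒x≈0∨y≈0 : ∀ {x y} → x * y ≈ 0# → x ≈ 0# ⊎ y ≈ 0#
  x*y≈0⇒x≈0∨y≈0 {x} {y} xy≈0 with x ≟ 0#
  ... | yes x≈0 = inj₁ x≈0
  ... | no x≉0  = inj₂ (*-cancelˡ-≉0 x≉0 (trans xy≈0 (sym (zeroʳ x))))

  x≉0∧y≉0⇒x*y≉0 : ∀ {x y} → ¬ x ≈ 0# → ¬ y ≈ 0# → ¬ x * y ≈ 0#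
  x≉0∧y≉0⇒x*y≉0 x≉0 y≉0 xy≈0 = [ x≉0 , y≉0 ] (x*y≈0⇒x≈0∨y≈0 xy≈0)

  ∏-≉0 : ∀ {m} (f : Fin m → Carrier) → (∀ i → ¬ f i ≈ 0#) → ¬ ∏ f ≈ 0#
  ∏-≉0 {zero}  f f≉0 = 0≉1 ∘ sym
  ∏-≉0 {suc m} f f≉0 = x≉0∧y≉0⇒x*y≉0 (f≉0 zero) (∏-≉0 (f ∘ suc) (f≉0 ∘ suc))

  private
    unit : Fin n → Carrier
    unit i = element (punchIn (index 0#) i)

    unit-≉0 : ∀ i → ¬ unit i ≈ 0#
    unit-≉0 i unitᵢ≈0 = FinP.punchInᵢ≢i _ i (element-injective (trans unitᵢ≈0 (sym (element-index 0#))))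

    unit-injective : ∀ {i j} → unit i ≈ unit j → i ≡.≡ j
    unit-injective = FinP.punchIn-injective _ _ _ ∘ element-injective

    toUnit : ∀ x → ¬ x ≈ 0# → Fin n
    toUnit x x≉0 = punchOut (x≉0 ∘ sym ∘ index-injective)

    unit-toUnit : ∀ x (x≉0 : ¬ x ≈ 0#) → unit (toUnit x x≉0) ≈ x
    unit-toUnit x x≉0 = trans (reflexive (≡.cong element (FinP.punchIn-punchOut _))) (element-index x)

    x*unit≉0 : ∀ {x} → ¬ x ≈ 0# → ∀ i → ¬ x * unit i ≈ 0#
    x*unit≉0 x≉0 i = x≉0∧y≉0⇒x*y≉0 x≉0 (unit-≉0 i)

    scale : ∀ x → ¬ x ≈ 0# → Fin n → Fin n
    scale x x≉0 i = toUnit (x * unit i) (x*unit≉0 x≉0 i)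

    unit-scale : ∀ x (x≉0 : ¬ x ≈ 0#) i → unit (scale x x≉0 i) ≈ x * unit i
    unit-scale x x≉0 i = unit-toUnit (x * unit i) (x*unit≉0 x≉0 i)

    scale-inverse : ∀ x y (x≉0 : ¬ x ≈ 0#) (y≉0 : ¬ y ≈ 0#) → x * y ≈ 1# →
                    ∀ i → scale x x≉0 (scale y y≉0 i) ≡.≡ i
    scale-inverse x y x≉0 y≉0 xy≈1 i = unit-injective (begin
      unit (scale x x≉0 (scale y y≉0 i)) ≈⟨ unit-scale x x≉0 _ ⟩
      x * unit (scale y y≉0 i)           ≈⟨ *-congˡ (unit-scale y y≉0 i) ⟩
      x * (y * unit i)                   ≈⟨ *-inverse-cancel (unit i) (trans (*-comm y x) xy≈1) ⟩
      unit i                             ∎)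

  -- Multiplication by x permutes the nonzero elements, so their product P satisfies P = xⁿ P.
  fermat : ∀ {x} → ¬ x ≈ 0# → x ^ n ≈ 1#
  fermat {x} x≉0 = *-cancelˡ-≉0 (∏-≉0 unit unit-≉0) (begin
    ∏ unit * x ^ n                 ≈⟨ *-congˡ (∏-replicate n) ⟨
    ∏ unit * ∏ {n} (λ _ → x)           ≈⟨ *-comm _ _ ⟩
    ∏ {n} (λ _ → x) * ∏ unit           ≈⟨ ∏-distrib-* (λ _ → x) unit ⟨
    ∏ (λ i → x * unit i)           ≈⟨ ∏-cong (λ i → unit-scale x x≉0 i) ⟨
    ∏ (λ i → unit (scale x x≉0 i))   ≈⟨ ∏-permute unit π ⟨
    ∏ unit                         ≈⟨ *-identityʳ _ ⟨
    ∏ unit * 1#                    ∎)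
    where
    y = proj₁ (inverse x≉0)
    xy≈1 = proj₂ (inverse x≉0)
    y≉0 : ¬ y ≈ 0#
    y≉0 y≈0 = 0≉1 (trans (sym (zeroʳ x)) (trans (*-congˡ (sym y≈0)) xy≈1))
    π = permutation (scale x x≉0) (scale y y≉0) (scale-inverse x y x≉0 y≉0 xy≈1)
      (scale-inverse y x y≉0 x≉0 (trans (*-comm y x) xy≈1))

  odd⇒1+1≈0 : (∃ λ k → n ≡.≡ suc (k ℕ.+ k)) → 1# + 1# ≈ 0#
  odd⇒1+1≈0 (k , n≡2k+1) = trans (+-congˡ (sym -1≈1)) (-‿inverseʳ 1#)
    where
    -1≉0 : ¬ - 1# ≈ 0#
    -1≉0 -1≈0 = 0≉1 (sym (trans (sym (-‿involutive 1#)) (trans (-‿cong -1≈0) -0#≈0#)))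

    -1≈1 : - 1# ≈ 1#
    -1≈1 = begin
      - 1#                              ≈⟨ *-identityʳ _ ⟨
      - 1# * 1#                         ≈⟨ *-congˡ (1^n≈1 k) ⟨
      - 1# * 1# ^ k                     ≈⟨ *-congˡ (^-congˡ k (trans (-1*x≈-x (- 1#)) (-‿involutive 1#))) ⟨
      - 1# * (- 1# * - 1#) ^ k          ≈⟨ *-congˡ (^-distrib-* (- 1#) (- 1#) k) ⟩
      - 1# * ((- 1#) ^ k * (- 1#) ^ k)  ≈⟨ *-congˡ (^-homo-* (- 1#) k k) ⟨
      (- 1#) ^ suc (k ℕ.+ k)            ≡⟨ ≡.cong ((- 1#) ^_) n≡2k+1 ⟨
      (- 1#) ^ n                        ≈⟨ fermat -1≉0 ⟩
      1#                                ∎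

module Quadratic {c ℓ} (F : CommutativeRing c ℓ) (isField : IsField F) {n : ℕ} (card : HasCard F (suc n))
  (1+1≈0 : HasCharacteristic2 F) where
  open CommutativeRing F hiding (zero)
  open FiniteField F isField card
  open Characteristic2 F 1+1≈0
  open SetoidReasoning setoid
  open import Algebra.Solver.Ring.NaturalCoefficients.Default commutativeSemiring using (solve; _:=_; _:+_; _:*_)

  IsRoot : Carrier → Carrier → Set ℓ
  IsRoot a x = a * (x * x) + x + a ≈ 0#

  IsRoot-cong : ∀ {a a′ x x′} → a ≈ a′ → x ≈ x′ → IsRoot a x → IsRoot a′ x′
  IsRoot-cong a≈a′ x≈x′ =
    trans (+-cong (+-cong (*-cong (sym a≈a′) (*-cong (sym x≈x′) (sym x≈x′))) (sym x≈x′)) (sym a≈a′))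

  1-not-root : ∀ a → ¬ IsRoot a 1#
  1-not-root a root = 0≉1 (begin
    0#                     ≈⟨ root ⟨
    a * (1# * 1#) + 1# + a ≈⟨ +-congʳ (+-congʳ (trans (*-congˡ (*-identityʳ 1#)) (*-identityʳ a))) ⟩
    a + 1# + a             ≈⟨ +-assoc a 1# a ⟩
    a + (1# + a)           ≈⟨ +-congˡ (+-comm 1# a) ⟩
    a + (a + 1#)           ≈⟨ x+[x+y]≈y a 1# ⟩
    1#                     ∎)

  0-root⇒≈0 : ∀ {a} → IsRoot a 0# → a ≈ 0#
  0-root⇒≈0 {a} root = begin
    a                      ≈⟨ +-identityˡ a ⟨
    0# + a                 ≈⟨ +-congʳ (+-identityʳ 0#) ⟨
    0# + 0# + a            ≈⟨ +-congʳ (+-congʳ (trans (*-congˡ (zeroʳ 0#)) (zeroʳ a))) ⟨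
    a * (0# * 0#) + 0# + a ≈⟨ root ⟩
    0#                     ∎

  rootless⇒≉0 : ∀ {a} → (∀ x → ¬ IsRoot a x) → ¬ a ≈ 0#
  rootless⇒≉0 {a} rootless a≈0 = rootless 0# (begin
    a * (0# * 0#) + 0# + a ≈⟨ +-cong (+-identityʳ _) a≈0 ⟩
    a * (0# * 0#) + 0#     ≈⟨ +-identityʳ _ ⟩
    a * (0# * 0#)          ≈⟨ trans (*-congˡ (zeroʳ 0#)) (zeroʳ a) ⟩
    0#                     ∎)

  root-inverse : ∀ {a x y} → x * y ≈ 1# → IsRoot a y → IsRoot a x
  root-inverse {a} {x} {y} xy≈1 root = begin
    a * (x * x) + x + a                                 ≈⟨ +-cong (+-congˡ x≈x[xy]) a≈a[xy]² ⟩
    a * (x * x) + x * (x * y) + a * ((x * y) * (x * y)) ≈⟨ solve 3 (λ a x y →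
      a :* (x :* x) :+ x :* (x :* y) :+ a :* ((x :* y) :* (x :* y)) :=
      (x :* x) :* (a :* (y :* y) :+ y :+ a)) refl a x y ⟩
    (x * x) * (a * (y * y) + y + a)                     ≈⟨ *-congˡ root ⟩
    (x * x) * 0#                                        ≈⟨ zeroʳ _ ⟩
    0#                                                  ∎
    where
    x≈x[xy] : x ≈ x * (x * y)
    x≈x[xy] = trans (sym (*-identityʳ x)) (*-congˡ (sym xy≈1))
    a≈a[xy]² : a ≈ a * ((x * y) * (x * y))
    a≈a[xy]² = trans (sym (*-identityʳ a)) (*-congˡ (sym (trans (*-cong xy≈1 xy≈1) (*-identityʳ 1#))))

  x*x≈1⇒x≈1 : ∀ {x} → x * x ≈ 1# → x ≈ 1#
  x*x≈1⇒x≈1 {x} x²≈1 = x+y≈0⇒x≈y ([ id , id ] (x*y≈0⇒x≈0∨y≈0 (begin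
    (x + 1#) * (x + 1#) ≈⟨ [x+1]²≈x²+1 x ⟩
    x * x + 1#          ≈⟨ +-congʳ x²≈1 ⟩
    1# + 1#             ≈⟨ 1+1≈0 ⟩
    0#                  ∎)))

  -- Subtracting the two equations leaves (a + b) (x + 1)² = 0, and x ≠ 1 since 1 is never a root.
  common-root : ∀ {a b x} → IsRoot a x → IsRoot b x → a ≈ b
  common-root {a} {b} {x} root-a root-b =
    x+y≈0⇒x≈y ([ id , ⊥-elim ∘ x≉0∧y≉0⇒x*y≉0 x+1≉0 x+1≉0 ]
      (x*y≈0⇒x≈0∨y≈0 [a+b][x+1]²≈0))
    where
    x+1≉0 : ¬ x + 1# ≈ 0#
    x+1≉0 x+1≈0 = 1-not-root a (IsRoot-cong refl (x+y≈0⇒x≈y x+1≈0) root-a)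

    [a+b][x+1]²≈0 : (a + b) * ((x + 1#) * (x + 1#)) ≈ 0#
    [a+b][x+1]²≈0 = begin
      (a + b) * ((x + 1#) * (x + 1#))                         ≈⟨ *-congˡ ([x+1]²≈x²+1 x) ⟩
      (a + b) * (x * x + 1#)                                  ≈⟨ +-identityʳ _ ⟨
      (a + b) * (x * x + 1#) + 0#                             ≈⟨ +-congˡ (x+x≈0 x) ⟨
      (a + b) * (x * x + 1#) + (x + x)                        ≈⟨ solve 4 (λ a b x o →
        (a :+ b) :* (x :* x :+ o) :+ (x :+ x) :=
        (a :* (x :* x) :+ x :+ a :* o) :+ (b :* (x :* x) :+ x :+ b :* o)) refl a b x 1# ⟩
      (a * (x * x) + x + a * 1#) + (b * (x * x) + x + b * 1#) ≈⟨ +-cong (trans (+-congˡ (*-identityʳ a)) root-a)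
                                                                        (trans (+-congˡ (*-identityʳ b)) root-b) ⟩
      0# + 0#                                                 ≈⟨ +-identityʳ 0# ⟩
      0#                                                      ∎

  private
    Chosen : Carrier → Carrier → Set ℓ
    Chosen a x = IsRoot a x ⊎ (a ≈ 1# × x ≈ 1#)

    Chosen-congʳ : ∀ {a x y} → x ≈ y → Chosen a x → Chosen a y
    Chosen-congʳ x≈y (inj₁ root)       = inj₁ (IsRoot-cong refl x≈y root)
    Chosen-congʳ x≈y (inj₂ (a≈1 , x≈1)) = inj₂ (a≈1 , trans (sym x≈y) x≈1)

    Chosen-injective : ∀ {a b x} → Chosen a x → Chosen b x → a ≈ b
    Chosen-injective         (inj₁ root-a)     (inj₁ root-b)     = common-root root-a root-b
    Chosen-injective {a}     (inj₁ root-a)     (inj₂ (_ , x≈1))  =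
      ⊥-elim (1-not-root a (IsRoot-cong refl x≈1 root-a))
    Chosen-injective {b = b} (inj₂ (_ , x≈1))  (inj₁ root-b)     =
      ⊥-elim (1-not-root b (IsRoot-cong refl x≈1 root-b))
    Chosen-injective         (inj₂ (a≈1 , _))  (inj₂ (b≈1 , _))  = trans a≈1 (sym b≈1)

  -- Choosing a root for each a ≠ 1 (and 1 for a = 1) would be injective, hence onto; but a root y₀ ∉ {0, 1}
  -- and its inverse y₀⁻¹ ≠ y₀ are roots of the same a, so y₀⁻¹ cannot be chosen for any a.
  ¬every-a≉1-has-root : 2 < suc n → ¬ (∀ a → ¬ a ≈ 1# → ∃ (IsRoot a))
  ¬every-a≉1-has-root 2<q has-root with third-element 2<q 0# 1#
  ... | a₀ , a₀≉0 , a₀≉1 = y₀≉1 (y₀≈1 (r-chosen j))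
    where
    choice : ∀ a → ∃ (Chosen a)
    choice a with a ≟ 1#
    ... | yes a≈1 = 1# , inj₂ (a≈1 , refl)
    ... | no a≉1  = proj₁ (has-root a a≉1) , inj₁ (proj₂ (has-root a a≉1))

    r : Fin (suc n) → Carrier
    r i = proj₁ (choice (element i))

    r-chosen : ∀ i → Chosen (element i) (r i)
    r-chosen i = proj₂ (choice (element i))

    r-injective : ∀ {i j} → r i ≈ r j → i ≡.≡ j
    r-injective rᵢ≈rⱼ =
      element-injective (Chosen-injective (Chosen-congʳ rᵢ≈rⱼ (r-chosen _)) (r-chosen _))

    y₀ : Carrier
    y₀ = r (index a₀)

    y₀-root : IsRoot a₀ y₀
    y₀-root with r-chosen (index a₀)
    ... | inj₁ root       = IsRoot-cong (element-index a₀) refl root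
    ... | inj₂ (a₀≈1 , _) = ⊥-elim (a₀≉1 (trans (sym (element-index a₀)) a₀≈1))

    y₀≉1 : ¬ y₀ ≈ 1#
    y₀≉1 y₀≈1 = 1-not-root a₀ (IsRoot-cong refl y₀≈1 y₀-root)

    y₀≉0 : ¬ y₀ ≈ 0#
    y₀≉0 y₀≈0 = a₀≉0 (0-root⇒≈0 (IsRoot-cong refl y₀≈0 y₀-root))

    y₀⁻¹ : Carrier
    y₀⁻¹ = proj₁ (inverse y₀≉0)

    y₀y₀⁻¹≈1 : y₀ * y₀⁻¹ ≈ 1#
    y₀y₀⁻¹≈1 = proj₂ (inverse y₀≉0)

    j : Fin (suc n)
    j = proj₁ (injective⇒surjective r r-injective y₀⁻¹)

    rⱼ≈y₀⁻¹ : r j ≈ y₀⁻¹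
    rⱼ≈y₀⁻¹ = proj₂ (injective⇒surjective r r-injective y₀⁻¹)

    y₀≈1 : Chosen (element j) (r j) → y₀ ≈ 1#
    y₀≈1 (inj₂ (_ , rⱼ≈1)) = begin
      y₀        ≈⟨ *-identityʳ y₀ ⟨
      y₀ * 1#   ≈⟨ *-congˡ (trans (sym rⱼ≈y₀⁻¹) rⱼ≈1) ⟨
      y₀ * y₀⁻¹ ≈⟨ y₀y₀⁻¹≈1 ⟩
      1#        ∎
    y₀≈1 (inj₁ root) = x*x≈1⇒x≈1 (trans (*-congˡ y₀≈y₀⁻¹) y₀y₀⁻¹≈1)
      where
      j≡index-a₀ : j ≡.≡ index a₀
      j≡index-a₀ = element-injective (common-root
        (root-inverse y₀y₀⁻¹≈1 (IsRoot-cong refl rⱼ≈y₀⁻¹ root))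
        (IsRoot-cong (sym (element-index a₀)) refl y₀-root))

      y₀≈y₀⁻¹ : y₀ ≈ y₀⁻¹
      y₀≈y₀⁻¹ = trans (reflexive (≡.cong r (≡.sym j≡index-a₀))) rⱼ≈y₀⁻¹

  private
    roots? : ∀ a → Dec (∃ (IsRoot a))
    roots? a = search (IsRoot-cong refl) (λ x → a * (x * x) + x + a ≟ 0#)

    Rootless : Carrier → Set (c ⊔ ℓ)
    Rootless a = ¬ a ≈ 1# × ¬ ∃ (IsRoot a)

    Rootless-cong : ∀ {a b} → a ≈ b → Rootless a → Rootless b
    Rootless-cong a≈b (a≉1 , rootless) =
      a≉1 ∘ trans a≈b , λ (x , root) → rootless (x , IsRoot-cong (sym a≈b) refl root)

  root-free-quadratic : 2 < suc n → ∃ λ a → ¬ a ≈ 1# × ∀ x → ¬ IsRoot a x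
  root-free-quadratic 2<q with search Rootless-cong (λ a → ¬? (a ≟ 1#) ×-dec ¬? (roots? a))
  ... | yes (a , a≉1 , rootless) = a , a≉1 , λ x root → rootless (x , root)
  ... | no none = ⊥-elim (¬every-a≉1-has-root 2<q has-root)
    where
    has-root : ∀ a → ¬ a ≈ 1# → ∃ (IsRoot a)
    has-root a a≉1 with roots? a
    ... | yes root    = root
    ... | no rootless = ⊥-elim (none (a , a≉1 , rootless))

module Continuants {c ℓ} (R : CommutativeRing c ℓ)
  (1+1≈0 : HasCharacteristic2 R) where
  open CommutativeRing R hiding (zero)
  open import Algebra.Properties.Ring ring using (-1*x≈-x)
  open Quiddity R
  open Characteristic2 R 1+1≈0
  open Setoid (×-setoid setoid setoid) public using ()
    renaming (_≈_ to _≈₂_; refl to ≈₂-refl; trans to ≈₂-trans)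

  push : Carrier × Carrier → Carrier → Carrier × Carrier
  push (x , y) c = c * x + y , x

  recurrence : Carrier × Carrier → List Carrier → Carrier × Carrier
  recurrence = foldl push

  continuant : List Carrier → Carrier
  continuant cs = proj₁ (recurrence (1# , 0#) cs)

  recurrence-cong : ∀ {p p′ cs cs′} → p ≈₂ p′ → cs ≈T cs′ →
                    recurrence p cs ≈₂ recurrence p′ cs′
  recurrence-cong p≈p′          []              = p≈p′
  recurrence-cong (x≈x′ , y≈y′) (c≈c′ ∷ cs≈cs′) =
    recurrence-cong (+-cong (*-cong c≈c′ x≈x′) y≈y′ , x≈x′) cs≈cs′

  recurrence-congˡ : ∀ {p p′} cs → p ≈₂ p′ → recurrence p cs ≈₂ recurrence p′ cs
  recurrence-congˡ cs p≈p′ = recurrence-cong {cs = cs} p≈p′ (Pointwise.refl refl)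

  recurrence-[0,1] : ∀ c cs → recurrence (0# , 1#) (c ∷ cs) ≈₂ recurrence (1# , 0#) cs
  recurrence-[0,1] c cs = recurrence-congˡ cs (trans (+-congʳ (zeroʳ c)) (+-identityˡ 1#) , refl)

  column₁ column₂ : Mat → Carrier × Carrier
  column₁ (mat a _ c _) = a , c
  column₂ (mat _ b _ d) = b , d

  -- Mtuple is defined by a local accumulator loop in Defs; unification recovers that loop as Mloop.
  private
    mutual
      Mloop : Mat → List Carrier → Mat
      Mloop = _

      Mtuple≡Mloop : ∀ cs → Mtuple cs ≡.≡ Mloop Id cs
      Mtuple≡Mloop cs with Id
      ... | _ = ≡.refl

    S-column : ∀ c x y → (c * x + - 1# * y , 1# * x + 0# * y) ≈₂ push (x , y) c
    S-column c x y =
      +-congˡ (trans (-1*x≈-x y) (-x≈x y)) , trans (+-cong (*-identityˡ x) (zeroˡ y)) (+-identityʳ x)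

    Mloop-columns : ∀ M cs → column₁ (Mloop M cs) ≈₂ recurrence (column₁ M) cs
                           × column₂ (Mloop M cs) ≈₂ recurrence (column₂ M) cs
    Mloop-columns M        []       = ≈₂-refl , ≈₂-refl
    Mloop-columns (mat p q r s) (c ∷ cs) =
      ≈₂-trans (proj₁ loop) (recurrence-congˡ cs (S-column c p r)) ,
      ≈₂-trans (proj₂ loop) (recurrence-congˡ cs (S-column c q s))
      where loop = Mloop-columns (S c · mat p q r s) cs

  Mtuple-column₁ : ∀ cs → column₁ (Mtuple cs) ≈₂ recurrence (1# , 0#) cs
  Mtuple-column₁ cs rewrite Mtuple≡Mloop cs = proj₁ (Mloop-columns Id cs)

  Mtuple-column₂ : ∀ cs → column₂ (Mtuple cs) ≈₂ recurrence (0# , 1#) cs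
  Mtuple-column₂ cs rewrite Mtuple≡Mloop cs = proj₂ (Mloop-columns Id cs)

  recurrences⇒λ-quiddity : ∀ cs → recurrence (1# , 0#) cs ≈₂ (1# , 0#) →
                           recurrence (0# , 1#) cs ≈₂ (0# , 1#) → IsLambdaQuiddity cs
  recurrences⇒λ-quiddity cs (m₁₁ , m₂₁) (m₁₂ , m₂₂) = inj₁
    (trans (proj₁ col₁) m₁₁ , trans (proj₁ col₂) m₁₂ , trans (proj₂ col₁) m₂₁ , trans (proj₂ col₂) m₂₂)
    where
    col₁ = Mtuple-column₁ cs
    col₂ = Mtuple-column₂ cs

  -- The lower right entry of M(b, c₁, …, cₘ, z) is the continuant of c₁, …, cₘ.
  λ-quiddity⇒continuant≈1 : ∀ b cs z → IsLambdaQuiddity (b ∷ cs ∷ʳ z) → continuant cs ≈ 1#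
  λ-quiddity⇒continuant≈1 b cs z quiddity = begin
    continuant cs                              ≡⟨ ≡.cong proj₂ (foldl-∷ʳ push (1# , 0#) z cs) ⟨
    proj₂ (recurrence (1# , 0#) (cs ∷ʳ z))     ≈⟨ proj₂ (recurrence-[0,1] b (cs ∷ʳ z)) ⟨
    proj₂ (recurrence (0# , 1#) (b ∷ cs ∷ʳ z)) ≈⟨ proj₂ (Mtuple-column₂ (b ∷ cs ∷ʳ z)) ⟨
    Mat.m22 (Mtuple (b ∷ cs ∷ʳ z))             ≈⟨ [ entry₂₂ , (λ M≈-Id → trans (entry₂₂ M≈-Id) (-x≈x 1#)) ]
                                                    quiddity ⟩
    1#                                         ∎
    where
    open SetoidReasoning setoid
    entry₂₂ : ∀ {M N} → M ≈M N → Mat.m22 M ≈ Mat.m22 N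
    entry₂₂ = proj₂ ∘ proj₂ ∘ proj₂

module Decomposition {c ℓ} (R : CommutativeRing c ℓ) where
  open Quiddity R

  init′-∷ʳ-lastOr : ∀ x xs → x ∷ xs ≡.≡ init′ (x ∷ xs) ∷ʳ lastOr x xs
  init′-∷ʳ-lastOr x []       = ≡.refl
  init′-∷ʳ-lastOr x (y ∷ xs) = ≡.cong (x ∷_) (init′-∷ʳ-lastOr y xs)

  length-init′ : ∀ x xs → length (init′ (x ∷ xs)) ≡.≡ length xs
  length-init′ x []       = ≡.refl
  length-init′ x (y ∷ xs) = ≡.cong suc (length-init′ y xs)

  drop-init′-++ : ∀ x xs y ys → drop (length (x ∷ xs)) (init′ (x ∷ xs) ++ y ∷ ys) ≡.≡ ys
  drop-init′-++ x []        y ys = ≡.refl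
  drop-init′-++ x (x′ ∷ xs) y ys = drop-init′-++ x′ xs y ys

  drop-⊕ : ∀ a₁ a₂ as b₁ b₂ bs →
           drop (length (a₁ ∷ a₂ ∷ as)) ((a₁ ∷ a₂ ∷ as) ⊕ (b₁ ∷ b₂ ∷ bs)) ≡.≡ init′ (b₂ ∷ bs)
  drop-⊕ a₁ a₂ as b₁ b₂ bs = drop-init′-++ a₂ as _ (init′ (b₂ ∷ bs))

  drop⁺ : ∀ k {xs ys} → xs ≈T ys → drop k xs ≈T drop k ys
  drop⁺ zero    xs≈ys         = xs≈ys
  drop⁺ (suc k) []            = []
  drop⁺ (suc k) (_ ∷ xs≈ys) = drop⁺ k xs≈ys

module PeriodicWord {ℓ} {A : Set ℓ} (a b : A) where

  data Phase : Set where
    aab aba baa : Phase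

  next : Phase → Phase
  next aab = aba
  next aba = baa
  next baa = aab

  letter : Phase → A
  letter aab = a
  letter aba = a
  letter baa = b

  word : Phase → ℕ → List A
  word φ zero    = []
  word φ (suc L) = letter φ ∷ word (next φ) L

  shift : ℕ → Phase → Phase
  shift zero    φ = φ
  shift (suc k) φ = shift k (next φ)

  length-word : ∀ φ L → length (word φ L) ≡.≡ L
  length-word φ zero    = ≡.refl
  length-word φ (suc L) = ≡.cong suc (length-word (next φ) L)

  shift-+ : ∀ m n φ → shift (m ℕ.+ n) φ ≡.≡ shift n (shift m φ)
  shift-+ zero    n φ = ≡.refl
  shift-+ (suc m) n φ = shift-+ m n (next φ)

  shift-*3 : ∀ j φ → shift (j ℕ.* 3) φ ≡.≡ φ
  shift-*3 zero    φ   = ≡.refl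
  shift-*3 (suc j) aab = shift-*3 j aab
  shift-*3 (suc j) aba = shift-*3 j aba
  shift-*3 (suc j) baa = shift-*3 j baa

  word-+ : ∀ m n φ → word φ (m ℕ.+ n) ≡.≡ word φ m ++ word (shift m φ) n
  word-+ zero    n φ = ≡.refl
  word-+ (suc m) n φ = ≡.cong (letter φ ∷_) (word-+ m n (next φ))

  drop-word : ∀ k L φ → drop k (word φ L) ≡.≡ word (shift k φ) (L ∸ k)
  drop-word zero    L       φ = ≡.refl
  drop-word (suc k) zero    φ = ≡.refl
  drop-word (suc k) (suc L) φ = drop-word k L (next φ)

  take-word : ∀ {k L} φ → k ≤ L → take k (word φ L) ≡.≡ word φ k
  take-word φ z≤n       = ≡.refl
  take-word φ (s≤s k≤L) = ≡.cong (letter φ ∷_) (take-word (next φ) k≤L)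

  rotate-word : ∀ {k} j φ → k ≤ j ℕ.* 3 →
                drop k (word φ (j ℕ.* 3)) ++ take k (word φ (j ℕ.* 3)) ≡.≡ word (shift k φ) (j ℕ.* 3)
  rotate-word {k} j φ k≤T = begin
    drop k (word φ T) ++ take k (word φ T)     ≡⟨ ≡.cong₂ _++_ (drop-word k T φ) (take-word φ k≤T) ⟩
    word ψ (T ∸ k) ++ word φ k                 ≡⟨ ≡.cong (λ χ → word ψ (T ∸ k) ++ word χ k) shift-back ⟨
    word ψ (T ∸ k) ++ word (shift (T ∸ k) ψ) k ≡⟨ word-+ (T ∸ k) k ψ ⟨
    word ψ (T ∸ k ℕ.+ k)                       ≡⟨ ≡.cong (word ψ) (ℕP.m∸n+n≡m k≤T) ⟩
    word ψ T                                   ∎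
    where
    open ≡.≡-Reasoning
    T = j ℕ.* 3
    ψ = shift k φ
    shift-back : shift (T ∸ k) ψ ≡.≡ φ
    shift-back = begin
      shift (T ∸ k) (shift k φ) ≡⟨ shift-+ k (T ∸ k) φ ⟨
      shift (k ℕ.+ (T ∸ k)) φ   ≡⟨ ≡.cong (λ t → shift t φ) (ℕP.m+[n∸m]≡n k≤T) ⟩
      shift T φ                 ≡⟨ shift-*3 j φ ⟩
      φ                         ∎

  reverse-word : ∀ j → reverse (word aab (j ℕ.* 3)) ≡.≡ word baa (j ℕ.* 3)
  reverse-word zero    = ≡.refl
  reverse-word (suc j) = begin
    reverse (word aab 3 ++ word aab (j ℕ.* 3))         ≡⟨ reverse-++ (word aab 3) (word aab (j ℕ.* 3)) ⟩
    reverse (word aab (j ℕ.* 3)) ++ word baa 3         ≡⟨ ≡.cong (_++ word baa 3) (reverse-word j) ⟩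
    word baa (j ℕ.* 3) ++ word baa 3                   ≡⟨ ≡.cong (λ φ → word baa (j ℕ.* 3) ++ word φ 3)
                                                                 (shift-*3 j baa) ⟨
    word baa (j ℕ.* 3) ++ word (shift (j ℕ.* 3) baa) 3 ≡⟨ word-+ (j ℕ.* 3) 3 baa ⟨
    word baa (j ℕ.* 3 ℕ.+ 3)                           ≡⟨ ≡.cong (word baa) (ℕP.+-comm (j ℕ.* 3) 3) ⟩
    word baa (3 ℕ.+ j ℕ.* 3)                           ∎
    where open ≡.≡-Reasoning

module WordContinuants {c ℓ} (R : CommutativeRing c ℓ) (1+1≈0 : HasCharacteristic2 R) where
  open CommutativeRing R hiding (zero)
  open import Algebra.Properties.CommutativeSemiring.Exp commutativeSemiring using (_^_; ^-congˡ; ^-distrib-*)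
  open import Algebra.Solver.Ring.NaturalCoefficients.Default commutativeSemiring using (solve; _:=_; _:+_; _:*_)
  open Powers commutativeSemiring using (1^n≈1)
  open Characteristic2 R 1+1≈0
  open Continuants R 1+1≈0
  open Quiddity R using (rotate; IsLambdaQuiddity; Irreducible; _⊕_; _≈T_; _∼_; init′; lastOr)
  open Decomposition R

  module _ {a b : Carrier} (ab≈1 : a * b ≈ 1#) where
    open PeriodicWord a b

    private
      ba≈1 : b * a ≈ 1#
      ba≈1 = trans (*-comm b a) ab≈1

    read-ab : ∀ x y → b * (a * x + y) + x ≈ b * y
    read-ab x y = begin
      b * (a * x + y) + x       ≈⟨ solve 4 (λ a b x y →
        b :* (a :* x :+ y) :+ x := (b :* a) :* x :+ (x :+ b :* y)) refl a b x y ⟩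
      (b * a) * x + (x + b * y) ≈⟨ +-congʳ (trans (*-congʳ ba≈1) (*-identityˡ x)) ⟩
      x + (x + b * y)           ≈⟨ x+[x+y]≈y x (b * y) ⟩
      b * y                     ∎
      where open SetoidReasoning setoid

    read-aba : ∀ x y → recurrence (x , y) (word aba 3) ≈₂ (a * x , b * y)
    read-aba x y = (begin
      a * (b * (a * x + y) + x) + (a * x + y) ≈⟨ +-congʳ (*-congˡ (read-ab x y)) ⟩
      a * (b * y) + (a * x + y)               ≈⟨ solve 4 (λ a b x y →
        a :* (b :* y) :+ (a :* x :+ y) := (a :* b) :* y :+ (y :+ a :* x)) refl a b x y ⟩
      (a * b) * y + (y + a * x)               ≈⟨ +-congʳ (trans (*-congʳ ab≈1) (*-identityˡ y)) ⟩
      y + (y + a * x)                         ≈⟨ x+[x+y]≈y y (a * x) ⟩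
      a * x                                   ∎) , read-ab x y
      where open SetoidReasoning setoid

    -- Stated for r + j * 3, the shape of the decomposition produced by _divMod_.
    recurrence-aba : ∀ j r x y → recurrence (x , y) (word aba (r ℕ.+ j ℕ.* 3)) ≈₂
                                 recurrence (a ^ j * x , b ^ j * y) (word aba r)
    recurrence-aba j r x y rewrite ℕP.+-comm r (j ℕ.* 3) = periods j x y
      where
      periods : ∀ j x y → recurrence (x , y) (word aba (j ℕ.* 3 ℕ.+ r)) ≈₂
                          recurrence (a ^ j * x , b ^ j * y) (word aba r)
      periods zero    x y = recurrence-congˡ (word aba r) (sym (*-identityˡ x) , sym (*-identityˡ y))
      periods (suc j) x y = ≈₂-trans (recurrence-congˡ (word aba (j ℕ.* 3 ℕ.+ r)) (read-aba x y))
        (≈₂-trans (periods j (a * x) (b * y)) (recurrence-congˡ (word aba r) (power-step a x , power-step b y)))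
        where
        power-step : ∀ z w → z ^ j * (z * w) ≈ z ^ suc j * w
        power-step z w = solve 3 (λ p z w → p :* (z :* w) := (z :* p) :* w) refl (z ^ j) z w

    recurrence-from-aba : ∀ j r → recurrence (1# , 0#) (word aba (r ℕ.+ j ℕ.* 3)) ≈₂
                                  recurrence (a ^ j , 0#) (word aba r)
    recurrence-from-aba j r =
      ≈₂-trans (recurrence-aba j r 1# 0#) (recurrence-congˡ (word aba r) (*-identityʳ _ , zeroʳ _))

    recurrence-from-aab : ∀ j r → recurrence (1# , 0#) (word aab (suc (r ℕ.+ j ℕ.* 3))) ≈₂
                                  recurrence (a ^ suc j , b ^ j) (word aba r)
    recurrence-from-aab j r = ≈₂-trans (recurrence-aba j r (a * 1# + 0#) 1#)
      (recurrence-congˡ (word aba r) (aʲ[a1+0]≈aʲ⁺¹ , *-identityʳ _))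
      where
      aʲ[a1+0]≈aʲ⁺¹ : a ^ j * (a * 1# + 0#) ≈ a ^ suc j
      aʲ[a1+0]≈aʲ⁺¹ = trans (*-congˡ (trans (+-identityʳ _) (*-identityʳ a))) (*-comm _ a)

    recurrence-from-baa : ∀ j r → recurrence (1# , 0#) (word baa (2 ℕ.+ (r ℕ.+ j ℕ.* 3))) ≈₂
                                  recurrence (0# , b ^ suc j) (word aba r)
    recurrence-from-baa j r = ≈₂-trans (recurrence-aba j r (a * (b * 1# + 0#) + 1#) (b * 1# + 0#))
      (recurrence-congˡ (word aba r) (aʲ[ab+1]≈0 , bʲ[b1+0]≈bʲ⁺¹))
      where
      b1+0≈b : b * 1# + 0# ≈ b
      b1+0≈b = trans (+-identityʳ _) (*-identityʳ b)
      aʲ[ab+1]≈0 : a ^ j * (a * (b * 1# + 0#) + 1#) ≈ 0#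
      aʲ[ab+1]≈0 = trans (*-congˡ (trans (+-congʳ (trans (*-congˡ b1+0≈b) ab≈1)) 1+1≈0)) (zeroʳ _)
      bʲ[b1+0]≈bʲ⁺¹ : b ^ j * (b * 1# + 0#) ≈ b ^ suc j
      bʲ[b1+0]≈bʲ⁺¹ = trans (*-congˡ b1+0≈b) (*-comm _ b)

    aᵏbᵏ≈1 : ∀ k → a ^ k * b ^ k ≈ 1#
    aᵏbᵏ≈1 k = trans (sym (^-distrib-* a b k)) (trans (^-congˡ k ab≈1) (1^n≈1 k))

    bᵏ≈1⇒aᵏ≈1 : ∀ {k} → b ^ k ≈ 1# → a ^ k ≈ 1#
    bᵏ≈1⇒aᵏ≈1 {k} bᵏ≈1 = trans (sym (trans (*-congˡ bᵏ≈1) (*-identityʳ _))) (aᵏbᵏ≈1 k)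

    aᵏ≈1⇒bᵏ≈1 : ∀ {k} → a ^ k ≈ 1# → b ^ k ≈ 1#
    aᵏ≈1⇒bᵏ≈1 {k} aᵏ≈1 = trans (sym (trans (*-congʳ aᵏ≈1) (*-identityˡ _))) (aᵏbᵏ≈1 k)

    word-λ-quiddity : ∀ N → a ^ N ≈ 1# → IsLambdaQuiddity (word aab (N ℕ.* 3))
    word-λ-quiddity zero    _      = recurrences⇒λ-quiddity [] ≈₂-refl ≈₂-refl
    word-λ-quiddity (suc N) aᴺ⁺¹≈1 = recurrences⇒λ-quiddity (word aab (suc N ℕ.* 3))
      (≈₂-trans (recurrence-from-aab N 2) (trans (read-ab _ _) bᴺ⁺¹≈1 , a·aᴺ⁺¹+bᴺ≈0))
      (≈₂-trans (recurrence-[0,1] a (word aba (2 ℕ.+ N ℕ.* 3)))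
        (≈₂-trans (recurrence-from-aba N 2) (trans (read-ab _ _) (zeroʳ b) ,
                                             trans (+-identityʳ _) aᴺ⁺¹≈1)))
      where
      open SetoidReasoning setoid

      bᴺ⁺¹≈1 : b ^ suc N ≈ 1#
      bᴺ⁺¹≈1 = aᵏ≈1⇒bᵏ≈1 {suc N} aᴺ⁺¹≈1

      a·aᴺ⁺¹+bᴺ≈0 : a * a ^ suc N + b ^ N ≈ 0#
      a·aᴺ⁺¹+bᴺ≈0 = begin
        a * a ^ suc N + b ^ N ≈⟨ +-cong (trans (*-congˡ aᴺ⁺¹≈1) (*-identityʳ a)) (sym (*-identityˡ _)) ⟩
        a + 1# * b ^ N        ≈⟨ +-congˡ (*-congʳ ab≈1) ⟨
        a + (a * b) * b ^ N   ≈⟨ +-congˡ (*-assoc a b (b ^ N)) ⟩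
        a + a * b ^ suc N     ≈⟨ +-congˡ (trans (*-congˡ bᴺ⁺¹≈1) (*-identityʳ a)) ⟩
        a + a                 ≈⟨ x+x≈0 a ⟩
        0#                    ∎

    module Irreducibility (0≉1 : ¬ 0# ≈ 1#) {N} (0<N : 0 < N) (aᴺ≈1 : a ^ N ≈ 1#)
      (order : ∀ {k} → 0 < k → k < N → ¬ a ^ k ≈ 1#)
      (rootless : ∀ x → ¬ a * (x * x) + x + a ≈ 0#) where
      open SetoidReasoning setoid

      private
        b-order : ∀ {k} → 0 < k → k < N → ¬ b ^ k ≈ 1#
        b-order {k} 0<k k<N = order 0<k k<N ∘ bᵏ≈1⇒aᵏ≈1 {k}

        exponent<N : ∀ {k L} → suc (k ℕ.* 3) ≤ 3 ℕ.+ L → 3 ℕ.+ L ≤ N ℕ.* 3 → k < N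
        exponent<N {k} k*3<3+L 3+L≤N*3 = ℕP.*-cancelʳ-< 3 k N (ℕP.≤-trans k*3<3+L 3+L≤N*3)

        -- Multiplying a u + b ^ j = 1 by u = a ^ (j + 1) gives a u² + a = u.
        quadratic-continuant≉1 : ∀ j → ¬ a * a ^ suc j + b ^ j ≈ 1#
        quadratic-continuant≉1 j K≈1 = rootless u (begin
          a * (u * u) + u + a           ≈⟨ solve 2 (λ a u →
            a :* (u :* u) :+ u :+ a := u :+ (a :* (u :* u) :+ a)) refl a u ⟩
          u + (a * (u * u) + a)         ≈⟨ +-congˡ (+-congˡ ubʲ≈a) ⟨
          u + (a * (u * u) + u * b ^ j) ≈⟨ +-congˡ (solve 3 (λ a u v →
            a :* (u :* u) :+ u :* v := u :* (a :* u :+ v)) refl a u (b ^ j)) ⟩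
          u + u * (a * u + b ^ j)       ≈⟨ +-congˡ (trans (*-congˡ K≈1) (*-identityʳ u)) ⟩
          u + u                         ≈⟨ x+x≈0 u ⟩
          0#                            ∎)
          where
          u = a ^ suc j
          ubʲ≈a : u * b ^ j ≈ a
          ubʲ≈a = trans (*-assoc a (a ^ j) (b ^ j)) (trans (*-congˡ (aᵏbᵏ≈1 j)) (*-identityʳ a))

      aba-segment≉1 : ∀ L → 0 < L → 3 ℕ.+ L ≤ N ℕ.* 3 → ¬ continuant (word aba L) ≈ 1#
      aba-segment≉1 L 0<L bound K≈1 with L divMod 3
      ... | result zero    zero             ≡.refl = ℕP.<-irrefl ≡.refl 0<L
      ... | result (suc j) zero             ≡.refl = order {suc j} (s≤s z≤n) (exponent<N (ℕP.m≤n+m _ 2) bound)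
        (trans (sym (proj₁ (recurrence-from-aba (suc j) 0))) K≈1)
      ... | result j       (suc zero)       ≡.refl = order {suc j} (s≤s z≤n) (exponent<N ℕP.≤-refl bound)
        (trans (sym (trans (proj₁ (recurrence-from-aba j 1)) (+-identityʳ _))) K≈1)
      ... | result j       (suc (suc zero)) ≡.refl = 0≉1
        (trans (sym (trans (proj₁ (recurrence-from-aba j 2)) (trans (read-ab _ _) (zeroʳ b)))) K≈1)

      aab-segment≉1 : ∀ L → 3 ℕ.+ suc L ≤ N ℕ.* 3 → ¬ continuant (word aab (suc L)) ≈ 1#
      aab-segment≉1 L bound K≈1 with L divMod 3
      ... | result j zero             ≡.refl = order {suc j} (s≤s z≤n) (exponent<N ℕP.≤-refl bound)
        (trans (sym (proj₁ (recurrence-from-aab j 0))) K≈1)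
      ... | result j (suc zero)       ≡.refl = quadratic-continuant≉1 j
        (trans (sym (proj₁ (recurrence-from-aab j 1))) K≈1)
      ... | result j (suc (suc zero)) ≡.refl = b-order {suc j} (s≤s z≤n) (exponent<N (ℕP.m≤n+m _ 2) bound)
        (trans (sym (trans (proj₁ (recurrence-from-aab j 2)) (read-ab _ _))) K≈1)

      baa-segment≉1 : ∀ L → 3 ℕ.+ suc (suc L) ≤ N ℕ.* 3 → ¬ continuant (word baa (suc (suc L))) ≈ 1#
      baa-segment≉1 L bound K≈1 with L divMod 3
      ... | result j zero             ≡.refl = 0≉1
        (trans (sym (proj₁ (recurrence-from-baa j 0))) K≈1)
      ... | result j (suc zero)       ≡.refl = b-order {suc j} (s≤s z≤n) (exponent<N (ℕP.m≤n+m _ 2) bound)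
        (trans (sym (trans (proj₁ (recurrence-from-baa j 1)) (trans (+-congʳ (zeroʳ a)) (+-identityˡ _)))) K≈1)
      ... | result j (suc (suc zero)) ≡.refl = b-order {suc (suc j)} (s≤s z≤n) (exponent<N ℕP.≤-refl bound)
        (trans (sym (trans (proj₁ (recurrence-from-baa j 2)) (read-ab _ _))) K≈1)

      segment≉1 : ∀ φ L → 0 < L → 3 ℕ.+ L ≤ N ℕ.* 3 → ¬ continuant (word φ L) ≈ 1#
      segment≉1 aba L             0<L bound = aba-segment≉1 L 0<L bound
      segment≉1 aab (suc L)       _   bound = aab-segment≉1 L bound
      segment≉1 baa 1             _   bound =
        b-order {1} (s≤s z≤n) (exponent<N ℕP.≤-refl bound) ∘ trans (sym (+-identityʳ _))
      segment≉1 baa (suc (suc L)) _   bound = baa-segment≉1 L bound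

      no-decomposition : ∀ φ {as bs} → IsLambdaQuiddity bs → 3 ≤ length bs → 3 ≤ length as →
                         ¬ (as ⊕ bs) ≈T word φ (N ℕ.* 3)
      no-decomposition φ {a₁ ∷ a₂ ∷ as} {b₁ ∷ b₂ ∷ bs} quiddity (s≤s (s≤s 0<|bs|)) 3≤m@(s≤s (s≤s _))
                       as⊕bs≈word =
        segment≉1 (shift m φ) L 0<L 3+L≤T (trans (sym K-inner≈K-segment) K-inner≈1)
        where
        m = length (a₁ ∷ a₂ ∷ as)
        T = N ℕ.* 3
        L = T ∸ m
        inner = init′ (b₂ ∷ bs)

        inner≈segment : inner ≈T word (shift m φ) L
        inner≈segment =
          ≡.subst₂ _≈T_ (drop-⊕ a₁ a₂ as b₁ b₂ bs) (drop-word m T φ) (drop⁺ m as⊕bs≈word)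

        0<L : 0 < L
        0<L = ≡.subst (0 <_) |bs|≡L 0<|bs|
          where
          |bs|≡L : length bs ≡.≡ L
          |bs|≡L = ≡.trans (≡.sym (length-init′ b₂ bs))
                           (≡.trans (Pointwise-length inner≈segment) (length-word _ L))

        3+L≤T : 3 ℕ.+ L ≤ T
        3+L≤T = ℕP.≤-trans (ℕP.+-monoˡ-≤ L 3≤m) (ℕP.≤-reflexive (ℕP.m+[n∸m]≡n {m} m≤T))
          where
          m≤T : m ≤ T
          m≤T = ℕP.<⇒≤ (ℕP.m∸n≢0⇒n<m (ℕP.>⇒≢ 0<L))

        K-inner≈1 : continuant inner ≈ 1#
        K-inner≈1 = λ-quiddity⇒continuant≈1 b₁ inner (lastOr b₂ bs)
          (≡.subst IsLambdaQuiddity (≡.cong (b₁ ∷_) (init′-∷ʳ-lastOr b₂ bs)) quiddity)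

        K-inner≈K-segment : continuant inner ≈ continuant (word (shift m φ) L)
        K-inner≈K-segment = proj₁ (recurrence-cong ≈₂-refl inner≈segment)

      word-∼ : ∀ {xs} → word aab (N ℕ.* 3) ∼ xs → ∃ λ φ → xs ≈T word φ (N ℕ.* 3)
      word-∼ {xs} (k , k<T , rotation) with rotation
      ... | inj₁ xs≈rotation = shift k aab , ≡.subst (xs ≈T_) (rotate-word N aab k≤T) xs≈rotation
        where k≤T = ℕP.<⇒≤ (≡.subst (k <_) (length-word aab (N ℕ.* 3)) k<T)
      ... | inj₂ xs≈rotation = shift k baa ,
        ≡.subst (xs ≈T_) (≡.trans (≡.cong (rotate k) (reverse-word N)) (rotate-word N baa k≤T))
                xs≈rotation
        where k≤T = ℕP.<⇒≤ (≡.subst (k <_) (length-word aab (N ℕ.* 3)) k<T)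

      word-irreducible : Irreducible (word aab (N ℕ.* 3))
      word-irreducible = word-λ-quiddity N aᴺ≈1 ,
        ≡.subst (3 ≤_) (≡.sym (length-word aab (N ℕ.* 3))) (ℕP.*-monoˡ-≤ 3 0<N) ,
        λ (bs , as , quiddity , 3≤|bs| , 3≤|as| , word∼as⊕bs) →
          let (φ , as⊕bs≈word) = word-∼ word∼as⊕bs
          in  no-decomposition φ quiddity 3≤|bs| 3≤|as| as⊕bs≈word

irreducible-of-length-3n : ∀ {c ℓ} (F : CommutativeRing c ℓ) → IsField F → ∀ {n} → HasCard F (suc n) →
                           Prime n → (∃ λ k → n ≡.≡ suc (k ℕ.+ k)) →
                           ∃ λ cs → Quiddity.Irreducible F cs × length cs ≡.≡ n ℕ.* 3
irreducible-of-length-3n F isField {n} card n-prime n-odd =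
  word aab (n ℕ.* 3) , word-irreducible , length-word aab (n ℕ.* 3)
  where
  open CommutativeRing F hiding (zero)
  open import Algebra.Properties.CommutativeSemiring.Exp commutativeSemiring using (_^_)
  open Powers commutativeSemiring using (coprime-exponents⇒≈1)
  open FiniteField F isField card
  1+1≈0 = odd⇒1+1≈0 n-odd
  open Quadratic F isField card 1+1≈0

  1<n : 1 < n
  1<n = ℕ.nonTrivial⇒n>1 n {{prime⇒nonTrivial n-prime}}

  rootFree = root-free-quadratic (s≤s 1<n)
  a = proj₁ rootFree
  a≉1 = proj₁ (proj₂ rootFree)
  rootless = proj₂ (proj₂ rootFree)

  a≉0 : ¬ a ≈ 0#
  a≉0 = rootless⇒≉0 rootless

  aⁿ≈1 : a ^ n ≈ 1#
  aⁿ≈1 = fermat a≉0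

  order : ∀ {k} → 0 < k → k < n → ¬ a ^ k ≈ 1#
  order 0<k k<n aᵏ≈1 =
    a≉1 (coprime-exponents⇒≈1 (prime⇒coprime n-prime {{ℕ.>-nonZero 0<k}} k<n) aⁿ≈1 aᵏ≈1)

  open PeriodicWord a (proj₁ (inverse a≉0)) using (word; aab; length-word)
  open WordContinuants F 1+1≈0 using (module Irreducibility)
  open Irreducibility (proj₂ (inverse a≉0)) 0≉1 (ℕP.<⇒≤ 1<n) aⁿ≈1 order rootless

private
  -- t + (t + 0) is how 2 ^ suc p = 2 * 2 ^ p normalises, with t = 2 ^ p.
  2t∸1-odd : ∀ t → 0 < t → ∃ λ k → t ℕ.+ (t ℕ.+ 0) ∸ 1 ≡.≡ suc (k ℕ.+ k)
  2t∸1-odd (suc k) _ = k , ≡.trans (≡.cong (k ℕ.+_) (ℕP.+-identityʳ (suc k))) (ℕP.+-suc k k)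

open import Data.Nat using (_+_; _*_; _^_)

corollary6p13 : ∀ {c ℓ} (p : ℕ) → 1 ≤ p → Prime (2 ^ p ∸ 1) →
    (F : CommutativeRing c ℓ) → IsField F → HasCard F ((2 ^ p ∸ 1) + 1) →
    ∃[ cs ] (Quiddity.Irreducible F cs × 3 * (2 ^ p ∸ 1) ≤ length cs)
corollary6p13 zero () _ _ _ _
corollary6p13 (suc p) _ 2ᵖ⁺¹∸1-prime F isField card =
  cs , irreducible , ℕP.≤-reflexive (≡.trans (ℕP.*-comm 3 (2 ^ suc p ∸ 1)) (≡.sym length≡3n))
  where
  card′ = ≡.subst (HasCard F) (ℕP.+-comm (2 ^ suc p ∸ 1) 1) card
  long = irreducible-of-length-3n F isField card′ 2ᵖ⁺¹∸1-prime (2t∸1-odd (2 ^ p) (ℕP.m^n>0 2 p))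
  cs = proj₁ long
  irreducible = proj₁ (proj₂ long)
  length≡3n = proj₂ (proj₂ long)
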